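{- Let $k_1,k_2>0$, and let $$A=\begin{bmatrix}0 & J_{k_1,k_2} & X_1\\ J_{k_1,k_2} & 0 & X_2\\ X_3 & X_4 & Y\end{bmatrix},\qquad B=\begin{bmatrix}J_{k_1,k_2} & 0 & X_1\\ 0 & J_{k_1,k_2} & X_2\\ X_3 & X_4 & Y\end{bmatrix}$$ be Gram mates (so $\mathrm{rank}(A-B)=1$), where $X_1,X_2$ are $k_1\times t$, $X_3,X_4$ are $s\times k_2$ and $Y$ is $s\times t$. If the remaining matrix $Y$ is fixable, then $A$ is isomorphic to $B$.
   Context: $J_{p,q}$ is the $p\times q$ all-ones matrix. $(0,1)$ matrices $A,B$ are Gram mates if $AA^T=BB^T$, $A^TA=B^TB$, $A\ne B$; they are isomorphic if $B=PAQ$ for permutation matrices $P,Q$. For $(0,1)$ matrices $Z_1,Z_2$ of equal size, $\mathcal R_{Z_1,Z_2}$ is the set of triples $(P_1,P_2,Q)$ of permutation matrices with $Z_2=P_1Z_1Q$ and $Z_1=P_2Z_2Q$; for $Z_3,Z_4$ with the same number of rows, $\mathcal L_{Z_3,Z_4}$ is the set of triples $(P,Q_3,Q_4)$ of permutation matrices with $Z_3=PZ_3Q_3$ and $Z_4=PZ_4Q_4$. For $A,B$ of the displayed form, $Y$ is the remaining matrix, and it is fixable if there exist permutation matrices $P$ ($s\times s$) and $Q$ ($t\times t$) with $Y=PYQ$ such that either (i) $(P_1,P_2,Q)\in\mathcal R_{X_1,X_2}$ and $(P,Q_3,Q_4)\in\mathcal L_{X_3,X_4}$ for some permutation matrices $P_1,P_2,Q_3,Q_4$,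 or (ii) $(Q_3,Q_4,P^T)\in\mathcal R_{X_3^T,X_4^T}$ and $(Q^T,P_1,P_2)\in\mathcal L_{X_1^T,X_2^T}$ for some permutation matrices $P_1,P_2,Q_3,Q_4$. -}

module Defs where

open import Data.Nat using (ℕ; zero; suc; _+_; _*_; _≤_)
import Data.Fin
open import Data.Fin using (Fin; splitAt) renaming (_≟_ to _≟ᶠ_)
open import Data.Fin.Permutation using (Permutation′; _⟨$⟩ʳ_)
open import Data.Sum using (_⊎_; inj₁; inj₂)
open import Data.Product using (_×_; ∃; ∃-syntax; Σ-syntax)
open import Relation.Binary.PropositionalEquality using (_≡_)
open import Relation.Nullary using (¬_; yes; no)

Matrix : ℕ → ℕ → Set
Matrix m n = Fin m → Fin n → ℕ

_≈ᴹ_ : ∀ {m n} → Matrix m n → Matrix m n → Set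
A ≈ᴹ B = ∀ i j → A i j ≡ B i j
infix 4 _≈ᴹ_

Is01 : ∀ {m n} → Matrix m n → Set
Is01 A = ∀ i j → A i j ≡ 0 ⊎ A i j ≡ 1

J : (p q : ℕ) → Matrix p q
J p q i j = 1

O : (p q : ℕ) → Matrix p q
O p q i j = 0

_ᵀ : ∀ {m n} → Matrix m n → Matrix n m
(A ᵀ) i j = A j i
infix 10 _ᵀ

∑ : ∀ n → (Fin n → ℕ) → ℕ
∑ zero    f = 0
∑ (suc n) f = f Data.Fin.zero + ∑ n (λ i → f (Data.Fin.suc i))

_⊗_ : ∀ {m n p} → Matrix m n → Matrix n p → Matrix m p
_⊗_ {n = n} A B i k = ∑ n (λ j → A i j * B j k)
infixl 7 _⊗_

permMat : ∀ {n} → Permutation′ n → Matrix n n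
permMat σ i j with (σ ⟨$⟩ʳ i) ≟ᶠ j
... | yes _ = 1
... | no  _ = 0

block3 : ∀ {a₁ a₂ a₃ b₁ b₂ b₃} →
  Matrix a₁ b₁ → Matrix a₁ b₂ → Matrix a₁ b₃ →
  Matrix a₂ b₁ → Matrix a₂ b₂ → Matrix a₂ b₃ →
  Matrix a₃ b₁ → Matrix a₃ b₂ → Matrix a₃ b₃ →
  Matrix (a₁ + a₂ + a₃) (b₁ + b₂ + b₃)
block3 {a₁} {a₂} {a₃} {b₁} {b₂} {b₃} M₁₁ M₁₂ M₁₃ M₂₁ M₂₂ M₂₃ M₃₁ M₃₂ M₃₃ i j
  with splitAt (a₁ + a₂) i | splitAt (b₁ + b₂) j
... | inj₂ i₃ | inj₂ j₃ = M₃₃ i₃ j₃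
... | inj₂ i₃ | inj₁ j' with splitAt b₁ j'
...   | inj₁ j₁ = M₃₁ i₃ j₁
...   | inj₂ j₂ = M₃₂ i₃ j₂
block3 {a₁} M₁₁ M₁₂ M₁₃ M₂₁ M₂₂ M₂₃ M₃₁ M₃₂ M₃₃ i j
    | inj₁ i' | inj₂ j₃ with splitAt a₁ i'
...   | inj₁ i₁ = M₁₃ i₁ j₃
...   | inj₂ i₂ = M₂₃ i₂ j₃
block3 {a₁} {b₁ = b₁} M₁₁ M₁₂ M₁₃ M₂₁ M₂₂ M₂₃ M₃₁ M₃₂ M₃₃ i j
    | inj₁ i' | inj₁ j' with splitAt a₁ i' | splitAt b₁ j'
...   | inj₁ i₁ | inj₁ j₁ = M₁₁ i₁ j₁
...   | inj₁ i₁ | inj₂ j₂ = M₁₂ i₁ j₂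
...   | inj₂ i₂ | inj₁ j₁ = M₂₁ i₂ j₁
...   | inj₂ i₂ | inj₂ j₂ = M₂₂ i₂ j₂

GramMates : ∀ {m n} → Matrix m n → Matrix m n → Set
GramMates A B = Is01 A × Is01 B ×
  (A ⊗ A ᵀ ≈ᴹ B ⊗ B ᵀ) × (A ᵀ ⊗ A ≈ᴹ B ᵀ ⊗ B) × ¬ (A ≈ᴹ B)

Isomorphic : ∀ {m n} → Matrix m n → Matrix m n → Set
Isomorphic {m} {n} A B =
  ∃[ P ] ∃[ Q ] (B ≈ᴹ permMat {m} P ⊗ A ⊗ permMat {n} Q)

InR : ∀ {m n} (Z₁ Z₂ : Matrix m n) → Matrix m m → Matrix m m → Matrix n n → Set
InR Z₁ Z₂ P₁ P₂ Q = (Z₂ ≈ᴹ P₁ ⊗ Z₁ ⊗ Q) × (Z₁ ≈ᴹ P₂ ⊗ Z₂ ⊗ Q)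

InL : ∀ {m n₃ n₄} (Z₃ : Matrix m n₃) (Z₄ : Matrix m n₄) →
  Matrix m m → Matrix n₃ n₃ → Matrix n₄ n₄ → Set
InL Z₃ Z₄ P Q₃ Q₄ = (Z₃ ≈ᴹ P ⊗ Z₃ ⊗ Q₃) × (Z₄ ≈ᴹ P ⊗ Z₄ ⊗ Q₄)

Fixable : ∀ {k₁ k₂ s t} (X₁ X₂ : Matrix k₁ t) (X₃ X₄ : Matrix s k₂)
  (Y : Matrix s t) → Set
Fixable {k₁} {k₂} {s} {t} X₁ X₂ X₃ X₄ Y =
  Σ[ p ∈ Permutation′ s ] Σ[ q ∈ Permutation′ t ]
    let P = permMat p ; Q = permMat q in
    (Y ≈ᴹ P ⊗ Y ⊗ Q) ×
    ( (Σ[ p₁ ∈ Permutation′ k₁ ] Σ[ p₂ ∈ Permutation′ k₁ ]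
       Σ[ q₃ ∈ Permutation′ k₂ ] Σ[ q₄ ∈ Permutation′ k₂ ]
         InR X₁ X₂ (permMat p₁) (permMat p₂) Q ×
         InL X₃ X₄ P (permMat q₃) (permMat q₄))
    ⊎ (Σ[ p₁ ∈ Permutation′ k₁ ] Σ[ p₂ ∈ Permutation′ k₁ ]
       Σ[ q₃ ∈ Permutation′ k₂ ] Σ[ q₄ ∈ Permutation′ k₂ ]
         InR (X₃ ᵀ) (X₄ ᵀ) (permMat q₃) (permMat q₄) (P ᵀ) ×
         InL (X₁ ᵀ) (X₂ ᵀ) (Q ᵀ) (permMat p₁) (permMat p₂)))

matA matB : ∀ {k₁ k₂ s t} (X₁ X₂ : Matrix k₁ t) (X₃ X₄ : Matrix s k₂)
  (Y : Matrix s t) → Matrix (k₁ + k₁ + s) (k₂ + k₂ + t)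
matA {k₁} {k₂} X₁ X₂ X₃ X₄ Y =
  block3 (O k₁ k₂) (J k₁ k₂) X₁
         (J k₁ k₂) (O k₁ k₂) X₂
         X₃        X₄        Y
matB {k₁} {k₂} X₁ X₂ X₃ X₄ Y =
  block3 (J k₁ k₂) (O k₁ k₂) X₁
         (O k₁ k₂) (J k₁ k₂) X₂
         X₃        X₄        Y

module Submission where

-- Permuting the rows of A so that its first two block rows are exchanged turns
-- the corner [0 J; J 0] into [J 0; 0 J], whatever permutations act inside the
-- blocks, since 0 and J are invariant under them. In case (i) of fixability the
-- permutations inside the blocks carry the exchanged blocks (X₂ over X₁) back to
-- (X₁ over X₂) while fixing X₃, X₄ and Y; case (ii) is the same argument with
-- the two block columns exchanged.

open import Defs
open import Data.Nat using (ℕ; zero; suc; _+_; _*_; _≤_)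
open import Data.Nat.Properties using (+-identityʳ; *-identityʳ; *-zeroʳ)
open import Data.Fin using (Fin; splitAt)
import Data.Fin as Fin
open import Data.Fin.Properties using (suc-injective; +↔⊎)
open import Data.Fin.Permutation using (Permutation′; _⟨$⟩ʳ_; _⟨$⟩ˡ_; inverseˡ; inverseʳ; flip)
open import Data.Sum using (_⊎_; inj₁; inj₂; [_,_]′)
open import Data.Sum.Algebra using (⊎-comm)
open import Data.Sum.Function.Propositional using (_⊎-↔_)
open import Data.Product using (_×_; _,_; proj₁; proj₂; Σ-syntax)
open import Function.Bundles using (_↔_; Inverse)
open import Function.Properties.Inverse using (↔-refl; ↔-trans; ↔-sym)
open import Relation.Binary.PropositionalEquality using (_≡_; _≢_; refl; sym; trans; cong; cong₂; subst; module ≡-Reasoning)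
open import Relation.Nullary using (yes; no)
open import Data.Empty using (⊥-elim)
open import Function using (_∘_)

open Inverse using (to; from)

∑-zero : ∀ n (f : Fin n → ℕ) → (∀ j → f j ≡ 0) → ∑ n f ≡ 0
∑-zero zero    f f≡0 = refl
∑-zero (suc n) f f≡0 rewrite f≡0 Fin.zero = ∑-zero n (λ j → f (Fin.suc j)) (λ j → f≡0 (Fin.suc j))

∑-single : ∀ n (f : Fin n → ℕ) a → (∀ j → j ≢ a → f j ≡ 0) → ∑ n f ≡ f a
∑-single (suc n) f Fin.zero f≡0
  rewrite ∑-zero n (λ j → f (Fin.suc j)) (λ j → f≡0 (Fin.suc j) λ ()) = +-identityʳ _
∑-single (suc n) f (Fin.suc a) f≡0 rewrite f≡0 Fin.zero (λ ()) =
  ∑-single n (λ j → f (Fin.suc j)) a (λ j j≢a → f≡0 (Fin.suc j) (j≢a ∘ suc-injective))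

reindex : ∀ {m n m′ n′} → (Fin m → Fin m′) → (Fin n → Fin n′) → Matrix m′ n′ → Matrix m n
reindex f g M i j = M (f i) (g j)

infix 4 _Selects_
_Selects_ : ∀ {m n} → Matrix m n → (Fin m → Fin n) → Set
R Selects f = ∀ i → R i (f i) ≡ 1 × (∀ j → j ≢ f i → R i j ≡ 0)

permMat-selects : ∀ {n} (σ : Permutation′ n) → permMat σ Selects (σ ⟨$⟩ʳ_)
permMat-selects σ i = entry-1 , entry-0
  where
  entry-1 : permMat σ i (σ ⟨$⟩ʳ i) ≡ 1
  entry-1 with σ ⟨$⟩ʳ i Fin.≟ σ ⟨$⟩ʳ i
  ... | yes _ = refl
  ... | no σi≢σi = ⊥-elim (σi≢σi refl)
  entry-0 : ∀ j → j ≢ σ ⟨$⟩ʳ i → permMat σ i j ≡ 0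
  entry-0 j j≢σi with σ ⟨$⟩ʳ i Fin.≟ j
  ... | yes σi≡j = ⊥-elim (j≢σi (sym σi≡j))
  ... | no _ = refl

permMatᵀ-selects : ∀ {n} (σ : Permutation′ n) → permMat σ ᵀ Selects (σ ⟨$⟩ˡ_)
permMatᵀ-selects σ i = entry-1 , entry-0
  where
  entry-1 : permMat σ (σ ⟨$⟩ˡ i) i ≡ 1
  entry-1 = subst (λ k → permMat σ (σ ⟨$⟩ˡ i) k ≡ 1) (inverseʳ σ) (proj₁ (permMat-selects σ (σ ⟨$⟩ˡ i)))
  entry-0 : ∀ j → j ≢ σ ⟨$⟩ˡ i → permMat σ j i ≡ 0
  entry-0 j j≢σ⁻¹i = proj₂ (permMat-selects σ j) i
    (λ i≡σj → j≢σ⁻¹i (trans (sym (inverseˡ σ)) (cong (σ ⟨$⟩ˡ_) (sym i≡σj))))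

selects-⊗ : ∀ {m n p} {R : Matrix m n} {f} → R Selects f → (M : Matrix n p) →
  ∀ i k → (R ⊗ M) i k ≡ M (f i) k
selects-⊗ {n = n} {R = R} {f} R-selects M i k = begin
  ∑ n (λ j → R i j * M j k)   ≡⟨ ∑-single n _ (f i) (λ j j≢fi → cong (_* M j k) (proj₂ (R-selects i) j j≢fi)) ⟩
  R i (f i) * M (f i) k       ≡⟨ cong (_* M (f i) k) (proj₁ (R-selects i)) ⟩
  M (f i) k + 0               ≡⟨ +-identityʳ _ ⟩
  M (f i) k                   ∎
  where open ≡-Reasoning

⊗-selectsᵀ : ∀ {m n p} {S : Matrix p n} {g} → S Selects g → (M : Matrix m n) →
  ∀ i k → (M ⊗ S ᵀ) i k ≡ M i (g k)
⊗-selectsᵀ {n = n} {S = S} {g} S-selects M i k = begin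
  ∑ n (λ j → M i j * S k j)   ≡⟨ ∑-single n _ (g k) (λ j j≢gk →
                                   trans (cong (M i j *_) (proj₂ (S-selects k) j j≢gk)) (*-zeroʳ (M i j))) ⟩
  M i (g k) * S k (g k)       ≡⟨ cong (M i (g k) *_) (proj₁ (S-selects k)) ⟩
  M i (g k) * 1               ≡⟨ *-identityʳ _ ⟩
  M i (g k)                   ∎
  where open ≡-Reasoning

selects-⊗-⊗-selectsᵀ : ∀ {m n m′ n′} {R : Matrix m m′} {S : Matrix n n′} {f g} →
  R Selects f → S Selects g → (M : Matrix m′ n′) → R ⊗ M ⊗ S ᵀ ≈ᴹ reindex f g M
selects-⊗-⊗-selectsᵀ {R = R} R-selects S-selects M i k =
  trans (⊗-selectsᵀ S-selects (R ⊗ M) i k) (selects-⊗ R-selects M i _)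

≈ᴹ-reindex : ∀ {m n m′ n′} {R : Matrix m m′} {S : Matrix n n′} {f g}
  {M : Matrix m n} {N : Matrix m′ n′} →
  R Selects f → S Selects g → M ≈ᴹ R ⊗ N ⊗ S ᵀ → M ≈ᴹ reindex f g N
≈ᴹ-reindex {N = N} R-selects S-selects M≈ i j =
  trans (M≈ i j) (selects-⊗-⊗-selectsᵀ R-selects S-selects N i j)

isomorphic-by-reindexing : ∀ {m n} {A B : Matrix m n} (ρ : Permutation′ m) (κ : Permutation′ n) →
  B ≈ᴹ reindex (ρ ⟨$⟩ʳ_) (κ ⟨$⟩ˡ_) A → Isomorphic A B
isomorphic-by-reindexing {A = A} ρ κ B≈ = ρ , κ , λ i j →
  trans (B≈ i j) (sym (selects-⊗-⊗-selectsᵀ (permMat-selects ρ) (permMatᵀ-selects κ) A i j))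

conjugate : ∀ {m} {I : Set} → Fin m ↔ I → I ↔ I → Permutation′ m
conjugate e σ = ↔-trans e (↔-trans σ (↔-sym e))

module _ {m} {I : Set} (e : Fin m ↔ I) (σ : I ↔ I) where
  conjugate-ʳ : ∀ i → to e (conjugate e σ ⟨$⟩ʳ i) ≡ to σ (to e i)
  conjugate-ʳ i = Inverse.strictlyInverseˡ e _

  conjugate-ˡ : ∀ i → to e (conjugate e σ ⟨$⟩ˡ i) ≡ from σ (to e i)
  conjugate-ˡ i = Inverse.strictlyInverseˡ e _

Relabels : ∀ {I K : Set} → (I → K → ℕ) → (I → K → ℕ) → I ↔ I → K ↔ K → Set
Relabels G F σ τ = ∀ u v → G u v ≡ F (to σ u) (from τ v)

isomorphic-by-relabelling : ∀ {m n} {I K : Set} (eᴵ : Fin m ↔ I) (eᴷ : Fin n ↔ K)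
  {A B : Matrix m n} (F G : I → K → ℕ) →
  A ≈ᴹ (λ i j → F (to eᴵ i) (to eᴷ j)) → B ≈ᴹ (λ i j → G (to eᴵ i) (to eᴷ j)) →
  (σ : I ↔ I) (τ : K ↔ K) → Relabels G F σ τ → Isomorphic A B
isomorphic-by-relabelling eᴵ eᴷ {A} {B} F G A≈F B≈G σ τ G≈Fστ =
  isomorphic-by-reindexing ρ κ λ i j → begin
    B i j                                        ≡⟨ B≈G i j ⟩
    G (to eᴵ i) (to eᴷ j)                        ≡⟨ G≈Fστ _ _ ⟩
    F (to σ (to eᴵ i)) (from τ (to eᴷ j))        ≡⟨ sym (cong₂ F (conjugate-ʳ eᴵ σ i) (conjugate-ˡ eᴷ τ j)) ⟩
    F (to eᴵ (ρ ⟨$⟩ʳ i)) (to eᴷ (κ ⟨$⟩ˡ j))      ≡⟨ sym (A≈F _ _) ⟩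
    A (ρ ⟨$⟩ʳ i) (κ ⟨$⟩ˡ j)                      ∎
  where
  open ≡-Reasoning
  ρ = conjugate eᴵ σ
  κ = conjugate eᴷ τ

Index₃ : ℕ → ℕ → ℕ → Set
Index₃ a₁ a₂ a₃ = (Fin a₁ ⊎ Fin a₂) ⊎ Fin a₃

split₃ : ∀ {a₁ a₂ a₃} → Fin (a₁ + a₂ + a₃) ↔ Index₃ a₁ a₂ a₃
split₃ = ↔-trans +↔⊎ (+↔⊎ ⊎-↔ ↔-refl)

[_,_,_]₃ : ∀ {a₁ a₂ a₃} {C : Set} → (Fin a₁ → C) → (Fin a₂ → C) → (Fin a₃ → C) → Index₃ a₁ a₂ a₃ → C
[ f , g , h ]₃ = [ [ f , g ]′ , h ]′

blocks : ∀ {a₁ a₂ a₃ b₁ b₂ b₃} →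
  Matrix a₁ b₁ → Matrix a₁ b₂ → Matrix a₁ b₃ →
  Matrix a₂ b₁ → Matrix a₂ b₂ → Matrix a₂ b₃ →
  Matrix a₃ b₁ → Matrix a₃ b₂ → Matrix a₃ b₃ →
  Index₃ a₁ a₂ a₃ → Index₃ b₁ b₂ b₃ → ℕ
blocks M₁₁ M₁₂ M₁₃ M₂₁ M₂₂ M₂₃ M₃₁ M₃₂ M₃₃ =
  [ (λ x → [ M₁₁ x , M₁₂ x , M₁₃ x ]₃)
  , (λ x → [ M₂₁ x , M₂₂ x , M₂₃ x ]₃)
  , (λ x → [ M₃₁ x , M₃₂ x , M₃₃ x ]₃) ]₃

block3-blocks : ∀ {a₁ a₂ a₃ b₁ b₂ b₃}
  (M₁₁ : Matrix a₁ b₁) (M₁₂ : Matrix a₁ b₂) (M₁₃ : Matrix a₁ b₃)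
  (M₂₁ : Matrix a₂ b₁) (M₂₂ : Matrix a₂ b₂) (M₂₃ : Matrix a₂ b₃)
  (M₃₁ : Matrix a₃ b₁) (M₃₂ : Matrix a₃ b₂) (M₃₃ : Matrix a₃ b₃) →
  block3 M₁₁ M₁₂ M₁₃ M₂₁ M₂₂ M₂₃ M₃₁ M₃₂ M₃₃
    ≈ᴹ (λ i j → blocks M₁₁ M₁₂ M₁₃ M₂₁ M₂₂ M₂₃ M₃₁ M₃₂ M₃₃ (to split₃ i) (to split₃ j))
block3-blocks {a₁} {a₂} {a₃} {b₁} {b₂} {b₃} _ _ _ _ _ _ _ _ _ i j
  with splitAt (a₁ + a₂) i | splitAt (b₁ + b₂) j
... | inj₂ _  | inj₂ _  = refl
... | inj₂ _  | inj₁ j′ with splitAt b₁ j′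
...   | inj₁ _ = refl
...   | inj₂ _ = refl
block3-blocks {a₁} _ _ _ _ _ _ _ _ _ i j | inj₁ i′ | inj₂ _ with splitAt a₁ i′
...   | inj₁ _ = refl
...   | inj₂ _ = refl
block3-blocks {a₁} {b₁ = b₁} _ _ _ _ _ _ _ _ _ i j | inj₁ i′ | inj₁ j′ with splitAt a₁ i′ | splitAt b₁ j′
...   | inj₁ _ | inj₁ _ = refl
...   | inj₁ _ | inj₂ _ = refl
...   | inj₂ _ | inj₁ _ = refl
...   | inj₂ _ | inj₂ _ = refl

diag₃ : ∀ {a₁ a₂ a₃} → Permutation′ a₁ → Permutation′ a₂ → Permutation′ a₃ →
  Index₃ a₁ a₂ a₃ ↔ Index₃ a₁ a₂ a₃
diag₃ α β γ = (α ⊎-↔ β) ⊎-↔ γ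

swap₁₂ : ∀ {a₁ a₂ a₃} → Index₃ a₁ a₂ a₃ ↔ Index₃ a₂ a₁ a₃
swap₁₂ = ⊎-comm _ _ ⊎-↔ ↔-refl

module _ {k₁ k₂ s t} (X₁ X₂ : Matrix k₁ t) (X₃ X₄ : Matrix s k₂) (Y : Matrix s t) where
  blocksA blocksB : Index₃ k₁ k₁ s → Index₃ k₂ k₂ t → ℕ
  blocksA = blocks (O k₁ k₂) (J k₁ k₂) X₁ (J k₁ k₂) (O k₁ k₂) X₂ X₃ X₄ Y
  blocksB = blocks (J k₁ k₂) (O k₁ k₂) X₁ (O k₁ k₂) (J k₁ k₂) X₂ X₃ X₄ Y

  matA-blocks : matA X₁ X₂ X₃ X₄ Y ≈ᴹ (λ i j → blocksA (to split₃ i) (to split₃ j))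
  matA-blocks = block3-blocks (O k₁ k₂) (J k₁ k₂) X₁ (J k₁ k₂) (O k₁ k₂) X₂ X₃ X₄ Y

  matB-blocks : matB X₁ X₂ X₃ X₄ Y ≈ᴹ (λ i j → blocksB (to split₃ i) (to split₃ j))
  matB-blocks = block3-blocks (J k₁ k₂) (O k₁ k₂) X₁ (O k₁ k₂) (J k₁ k₂) X₂ X₃ X₄ Y

  module _ (p : Permutation′ s) (q : Permutation′ t) (Y≈ : Y ≈ᴹ reindex (p ⟨$⟩ʳ_) (q ⟨$⟩ˡ_) Y) where
    rowSwap-relabels : (p₁ p₂ : Permutation′ k₁) (q₃ q₄ : Permutation′ k₂) →
      X₂ ≈ᴹ reindex (p₁ ⟨$⟩ʳ_) (q ⟨$⟩ˡ_) X₁ → X₁ ≈ᴹ reindex (p₂ ⟨$⟩ʳ_) (q ⟨$⟩ˡ_) X₂ →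
      X₃ ≈ᴹ reindex (p ⟨$⟩ʳ_) (q₃ ⟨$⟩ˡ_) X₃ → X₄ ≈ᴹ reindex (p ⟨$⟩ʳ_) (q₄ ⟨$⟩ˡ_) X₄ →
      Relabels blocksB blocksA (↔-trans (diag₃ p₂ p₁ p) swap₁₂) (diag₃ q₃ q₄ q)
    rowSwap-relabels _ _ _ _ X₂≈ X₁≈ X₃≈ X₄≈ (inj₁ (inj₁ x)) (inj₁ (inj₁ y)) = refl
    rowSwap-relabels _ _ _ _ X₂≈ X₁≈ X₃≈ X₄≈ (inj₁ (inj₁ x)) (inj₁ (inj₂ y)) = refl
    rowSwap-relabels _ _ _ _ X₂≈ X₁≈ X₃≈ X₄≈ (inj₁ (inj₁ x)) (inj₂ y)        = X₁≈ x y
    rowSwap-relabels _ _ _ _ X₂≈ X₁≈ X₃≈ X₄≈ (inj₁ (inj₂ x)) (inj₁ (inj₁ y)) = refl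
    rowSwap-relabels _ _ _ _ X₂≈ X₁≈ X₃≈ X₄≈ (inj₁ (inj₂ x)) (inj₁ (inj₂ y)) = refl
    rowSwap-relabels _ _ _ _ X₂≈ X₁≈ X₃≈ X₄≈ (inj₁ (inj₂ x)) (inj₂ y)        = X₂≈ x y
    rowSwap-relabels _ _ _ _ X₂≈ X₁≈ X₃≈ X₄≈ (inj₂ x)        (inj₁ (inj₁ y)) = X₃≈ x y
    rowSwap-relabels _ _ _ _ X₂≈ X₁≈ X₃≈ X₄≈ (inj₂ x)        (inj₁ (inj₂ y)) = X₄≈ x y
    rowSwap-relabels _ _ _ _ X₂≈ X₁≈ X₃≈ X₄≈ (inj₂ x)        (inj₂ y)        = Y≈ x y

    columnSwap-relabels : (p₁ p₂ : Permutation′ k₁) (q₃ q₄ : Permutation′ k₂) →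
      X₄ ᵀ ≈ᴹ reindex (q₃ ⟨$⟩ʳ_) (p ⟨$⟩ʳ_) (X₃ ᵀ) → X₃ ᵀ ≈ᴹ reindex (q₄ ⟨$⟩ʳ_) (p ⟨$⟩ʳ_) (X₄ ᵀ) →
      X₁ ᵀ ≈ᴹ reindex (q ⟨$⟩ˡ_) (p₁ ⟨$⟩ˡ_) (X₁ ᵀ) → X₂ ᵀ ≈ᴹ reindex (q ⟨$⟩ˡ_) (p₂ ⟨$⟩ˡ_) (X₂ ᵀ) →
      Relabels blocksB blocksA
        (diag₃ (flip p₁) (flip p₂) p) (↔-trans swap₁₂ (diag₃ (flip q₄) (flip q₃) q))
    columnSwap-relabels _ _ _ _ X₄ᵀ≈ X₃ᵀ≈ X₁ᵀ≈ X₂ᵀ≈ (inj₁ (inj₁ x)) (inj₁ (inj₁ y)) = refl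
    columnSwap-relabels _ _ _ _ X₄ᵀ≈ X₃ᵀ≈ X₁ᵀ≈ X₂ᵀ≈ (inj₁ (inj₁ x)) (inj₁ (inj₂ y)) = refl
    columnSwap-relabels _ _ _ _ X₄ᵀ≈ X₃ᵀ≈ X₁ᵀ≈ X₂ᵀ≈ (inj₁ (inj₁ x)) (inj₂ y)        = X₁ᵀ≈ y x
    columnSwap-relabels _ _ _ _ X₄ᵀ≈ X₃ᵀ≈ X₁ᵀ≈ X₂ᵀ≈ (inj₁ (inj₂ x)) (inj₁ (inj₁ y)) = refl
    columnSwap-relabels _ _ _ _ X₄ᵀ≈ X₃ᵀ≈ X₁ᵀ≈ X₂ᵀ≈ (inj₁ (inj₂ x)) (inj₁ (inj₂ y)) = refl
    columnSwap-relabels _ _ _ _ X₄ᵀ≈ X₃ᵀ≈ X₁ᵀ≈ X₂ᵀ≈ (inj₁ (inj₂ x)) (inj₂ y)        = X₂ᵀ≈ y x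
    columnSwap-relabels _ _ _ _ X₄ᵀ≈ X₃ᵀ≈ X₁ᵀ≈ X₂ᵀ≈ (inj₂ x)        (inj₁ (inj₁ y)) = X₃ᵀ≈ y x
    columnSwap-relabels _ _ _ _ X₄ᵀ≈ X₃ᵀ≈ X₁ᵀ≈ X₂ᵀ≈ (inj₂ x)        (inj₁ (inj₂ y)) = X₄ᵀ≈ y x
    columnSwap-relabels _ _ _ _ X₄ᵀ≈ X₃ᵀ≈ X₁ᵀ≈ X₂ᵀ≈ (inj₂ x)        (inj₂ y)        = Y≈ x y

  fixable-relabels : Fixable X₁ X₂ X₃ X₄ Y →
    Σ[ σ ∈ Index₃ k₁ k₁ s ↔ Index₃ k₁ k₁ s ] Σ[ τ ∈ Index₃ k₂ k₂ t ↔ Index₃ k₂ k₂ t ]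
      Relabels blocksB blocksA σ τ
  fixable-relabels (p , q , Y≈ , inj₁ (p₁ , p₂ , q₃ , q₄ , (X₂≈ , X₁≈) , (X₃≈ , X₄≈))) =
    ↔-trans (diag₃ p₂ p₁ p) swap₁₂ , diag₃ q₃ q₄ q ,
    rowSwap-relabels p q (≈ᴹ-reindex (permMat-selects p) (permMatᵀ-selects q) Y≈) p₁ p₂ q₃ q₄
      (≈ᴹ-reindex (permMat-selects p₁) (permMatᵀ-selects q) X₂≈)
      (≈ᴹ-reindex (permMat-selects p₂) (permMatᵀ-selects q) X₁≈)
      (≈ᴹ-reindex (permMat-selects p) (permMatᵀ-selects q₃) X₃≈)
      (≈ᴹ-reindex (permMat-selects p) (permMatᵀ-selects q₄) X₄≈)
  fixable-relabels (p , q , Y≈ , inj₂ (p₁ , p₂ , q₃ , q₄ , (X₄ᵀ≈ , X₃ᵀ≈) , (X₁ᵀ≈ , X₂ᵀ≈))) =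
    diag₃ (flip p₁) (flip p₂) p , ↔-trans swap₁₂ (diag₃ (flip q₄) (flip q₃) q) ,
    columnSwap-relabels p q (≈ᴹ-reindex (permMat-selects p) (permMatᵀ-selects q) Y≈) p₁ p₂ q₃ q₄
      (≈ᴹ-reindex (permMat-selects q₃) (permMat-selects p) X₄ᵀ≈)
      (≈ᴹ-reindex (permMat-selects q₄) (permMat-selects p) X₃ᵀ≈)
      (≈ᴹ-reindex (permMatᵀ-selects q) (permMatᵀ-selects p₁) X₁ᵀ≈)
      (≈ᴹ-reindex (permMatᵀ-selects q) (permMatᵀ-selects p₂) X₂ᵀ≈)

proposition6p1 : (k₁ k₂ s t : ℕ) → 1 ≤ k₁ → 1 ≤ k₂ →
    (X₁ X₂ : Matrix k₁ t) (X₃ X₄ : Matrix s k₂) (Y : Matrix s t) →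
    Is01 X₁ → Is01 X₂ → Is01 X₃ → Is01 X₄ → Is01 Y →
    GramMates (matA X₁ X₂ X₃ X₄ Y) (matB X₁ X₂ X₃ X₄ Y) →
    Fixable X₁ X₂ X₃ X₄ Y →
    Isomorphic (matA X₁ X₂ X₃ X₄ Y) (matB X₁ X₂ X₃ X₄ Y)
proposition6p1 k₁ k₂ s t _ _ X₁ X₂ X₃ X₄ Y _ _ _ _ _ _ fixable =
  let σ , τ , relabels = fixable-relabels X₁ X₂ X₃ X₄ Y fixable in
  isomorphic-by-relabelling split₃ split₃ (blocksA X₁ X₂ X₃ X₄ Y) (blocksB X₁ X₂ X₃ X₄ Y)
    (matA-blocks X₁ X₂ X₃ X₄ Y) (matB-blocks X₁ X₂ X₃ X₄ Y) σ τ relabels
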